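{- Let $G_1,\ldots,G_n$ be nondeterministic automata, where $G_i$ has set of secret states $Q_i^S$, and consider the composed system $G_1\|\cdots\|G_n$ with interaction $\|_\lor$, i.e. with set of secret states $Q^S=Q\setminus(Q_1^{NS}\times\cdots\times Q_n^{NS})$, $Q_i^{NS}=Q_i\setminus Q_i^S$. For $1\le i\le n$ let $H_i$ be the two-way observer of $G_i$ with state set $X_{H_i}$, and let $H_{i,\psi_i}$ be its $\psi_i$-automaton with set of $\psi_i$-states $X^i_{\psi_i}=\{(X^i,X^i_R)\in X_{H_i}: X^i\cap X^i_R\subseteq Q_i^S\}$, where $\psi_1,\ldots,\psi_n$ are pairwise distinct new events. If $H_{1,\psi_1}\|\cdots\|H_{n,\psi_n}$ is nonblocking, then $G_1\|\cdots\|G_n$ is infinite-step opaque.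
   Context: An automaton is $G=\langle\Sigma_\tau,Q,\to,Q^\circ\rangle$ with finite set $\Sigma$ of observable events, a special unobservable event $\tau\notin\Sigma$, $\Sigma_\tau=\Sigma\cup\{\tau\}$, finite states $Q$, transitions $\to\subseteq Q\times\Sigma_\tau\times Q$, initial states $Q^\circ$, possibly marked states, and secret states $Q^S\subseteq Q$, $Q^{NS}=Q\setminus Q^S$. For $s\in\Sigma^*$, $p\stackrel{s}{\Rightarrow}q$ means there is $t\in\Sigma_\tau^*$ which becomes $s$ after deleting all $\tau$'s and $p\stackrel{t}{\to}q$; $p\stackrel{s}{\Rightarrow}$ means this for some $q$; $L(G,q)=\{s:q\stackrel{s}{\Rightarrow}\}$. Synchronous composition: states are tuples, initial (resp. marked) states are products of initial (resp. marked) states; a shared event (other than $\tau$, never shared) is executed jointly by all components having it in their alphabet; other events are executed by a single component while the others stay put. Infinite-step opacity: $G$ is infinite-step opaque w.r.t. $Q^S$ iff for every $q^\circ\in Q^\circ$ and all $s,t\in\Sigma^*$ with $st\in L(G,q^\circ)$ and $q^\circ\stackrel{s}{\Rightarrow}Q^S$, there exist $q'^\circ\in Q^\circ$ and $y\in Q^{NS}$ with $q'^\circ\stackrel{s}{\Rightarrow}y$ and $y\stackrel{t}{\Rightarrow}$. Reversed automaton: $G_R=\langle\Sigma_\tau,Q,\to_R,Q\rangle$ with $(x,\sigma,y)\in\to_R$ iff $y\stackrel{\sigma}{\to}x$, all states initial. Current-state estimator: $UR(B)$ is the set of states reachable from $B$ by strings in $\{\tau\}^*$; $det(G)$ is the deterministic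 automaton over $\Sigma$ with initial state $UR(Q^\circ)$ and transitions $X\stackrel{\sigma}{\to}Y$ where $Y=\bigcup\{UR(\{y\}): x\stackrel{\sigma}{\to}y, x\in X\}$ is nonempty; only reachable states are kept. Two-way observer: with renamings $\Delta(\sigma)=(\sigma,\epsilon)$, $\Delta_R(\sigma)=(\epsilon,\sigma)$ relabelling transitions, $H_i=\Delta(det(G_i))\|\Delta_R(det(G_{i,R}))$, a deterministic automaton over $\Delta(\Sigma_i)\cup\Delta_R(\Sigma_i)$ with reachable states $(X^i,X^i_R)$, $X^i,X^i_R\subseteq Q_i$. $\psi$-automaton: for a deterministic automaton $D=\langle\Sigma,Q_D,\to,q^\circ\rangle$, set $X_\psi\subseteq Q_D$ and new event $\psi$, $D_\psi=\langle\Sigma\cup\{\psi\},Q_D\cup\{\bot\},\to\cup\{(x,\psi,\bot):x\in X_\psi\},q^\circ,Q_D\rangle$, with $\bot$ a new unmarked state and all original states marked. An automaton is nonblocking if from every reachable state some marked state is reachable; otherwise blocking. -}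

module Defs where

open import Data.Nat using (ℕ)
open import Data.Fin using (Fin; zero; suc; _≟_)
open import Relation.Nullary.Decidable using (⌊_⌋)
open import Data.Fin.Subset using (Subset; _∈_; _∉_; Nonempty) renaming (⊤ to full)
open import Data.Bool using (Bool; true; false; _∨_)
open import Data.Maybe using (Maybe; just; nothing)
open import Data.List using (List; []; _∷_; _++_)
open import Data.Product using (Σ; ∃; ∃-syntax; _×_; _,_)
open import Data.Sum using (_⊎_; inj₁; inj₂)
open import Data.Unit using (⊤; tt)
open import Data.Empty using (⊥)
open import Relation.Nullary using (¬_)
open import Relation.Binary.PropositionalEquality using (_≡_; _≢_)

_⟺_ : Set → Set → Set
A ⟺ B = (A → B) × (B → A)

-- The unobservable event τ is 'nothing'; observable events are 'just e'.
-- 'alph e ≡ true' means e belongs to the automaton's alphabet.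

record Aut (E : Set) : Set₁ where
  field
    St      : Set
    alph    : E → Bool
    step    : St → Maybe E → St → Set
    initial : St → Set
    marked  : St → Set
open Aut public

data Run {E : Set} (A : Aut E) : St A → List E → St A → Set where
  done : ∀ {p} → Run A p [] p
  tau  : ∀ {p q r s} → step A p nothing q → Run A q s r → Run A p s r
  obs  : ∀ {p q r e s} → step A p (just e) q → Run A q s r → Run A p (e ∷ s) r

Reachable : {E : Set} (A : Aut E) → St A → Set
Reachable A x = ∃[ x₀ ] (initial A x₀ × ∃[ s ] Run A x₀ s x)

Nonblocking : {E : Set} → Aut E → Set
Nonblocking A = ∀ x → Reachable A x → ∃[ y ] (∃[ s ] Run A x s y × marked A y)

InfStepOpaque : {E : Set} (A : Aut E) → (St A → Set) → Set
InfStepOpaque {E} A secret =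
  ∀ q₀ → initial A q₀ → ∀ (s t : List E) →
  (∃[ r ] Run A q₀ (s ++ t) r) →
  (∃[ q ] (Run A q₀ s q × secret q)) →
  ∃[ q₀' ] (initial A q₀' × ∃[ y ] (Run A q₀' s y × ¬ secret y × ∃[ r ] Run A y t r))

anyF : (m : ℕ) → (Fin m → Bool) → Bool
anyF ℕ.zero f = false
anyF (ℕ.suc m) f = f zero ∨ anyF m (λ j → f (suc j))

Sync : {E : Set} (n : ℕ) → (Fin n → Aut E) → Aut E
Sync {E} n A = record
  { St      = (i : Fin n) → St (A i)
  ; alph    = λ e → anyAlph e
  ; step    = stp
  ; initial = λ x → ∀ i → initial (A i) (x i)
  ; marked  = λ x → ∀ i → marked (A i) (x i)
  }
  where
  anyAlph : E → Bool
  anyAlph e = anyF n (λ i → alph (A i) e)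
  stp : ((i : Fin n) → St (A i)) → Maybe E → ((i : Fin n) → St (A i)) → Set
  stp x (just e) y = (∃[ i ] alph (A i) e ≡ true) ×
    (∀ i → (alph (A i) e ≡ true → step (A i) (x i) (just e) (y i)) ×
           (alph (A i) e ≡ false → y i ≡ x i))
  stp x nothing y = ∃[ i ] (step (A i) (x i) nothing (y i) × (∀ j → j ≢ i → y j ≡ x j))

_∥_ : {E : Set} → Aut E → Aut E → Aut E
_∥_ {E} A B = record
  { St      = St A × St B
  ; alph    = λ e → alph A e ∨ alph B e
  ; step    = stp
  ; initial = λ { (a , b) → initial A a × initial B b }
  ; marked  = λ { (a , b) → marked A a × marked B b }
  }
  where
  stp : St A × St B → Maybe E → St A × St B → Set
  stp (a , b) (just e) (a' , b') =
    (alph A e ∨ alph B e ≡ true) ×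
    ((alph A e ≡ true → step A a (just e) a') × (alph A e ≡ false → a' ≡ a)) ×
    ((alph B e ≡ true → step B b (just e) b') × (alph B e ≡ false → b' ≡ b))
  stp (a , b) nothing (a' , b') =
    (step A a nothing a' × b' ≡ b) ⊎ (a' ≡ a × step B b nothing b')

record NFA (m : ℕ) : Set where
  field
    k      : ℕ
    alph   : Subset m
    trans  : Fin k → Maybe (Fin m) → Fin k → Bool
    init   : Subset k
    mark   : Subset k
    secret : Subset k
    wf     : ∀ p σ q → trans p (just σ) q ≡ true → σ ∈ alph
open NFA public

memb : {m : ℕ} → Fin m → Subset m → Bool
memb i p = Data.Vec.lookup p i
  where import Data.Vec

toAut : {m : ℕ} → NFA m → Aut (Fin m)
toAut G = record
  { St      = Fin (k G)
  ; alph    = λ σ → memb σ (alph G)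
  ; step    = λ p e q → trans G p e q ≡ true
  ; initial = λ q → q ∈ init G
  ; marked  = λ q → q ∈ mark G
  }

reverse : {m : ℕ} → NFA m → NFA m
reverse G = record
  { k = k G ; alph = alph G
  ; trans = λ x e y → trans G y e x
  ; init = full ; mark = mark G ; secret = secret G
  ; wf = λ p σ q h → wf G q σ p h }

InUR : {m : ℕ} (G : NFA m) → Subset (k G) → Fin (k G) → Set
InUR G B q = ∃[ p ] (p ∈ B × Run (toAut G) p [] q)

DetStep : {m : ℕ} (G : NFA m) → Subset (k G) → Fin m → Subset (k G) → Set
DetStep G X σ Y = Nonempty Y ×
  (∀ q → (q ∈ Y) ⟺ (∃[ x ] (x ∈ X × ∃[ y ] (trans G x (just σ) y ≡ true × Run (toAut G) y [] q))))

det : {m : ℕ} → NFA m → Aut (Fin m)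
det {m} G = record
  { St      = Subset (k G)
  ; alph    = λ σ → memb σ (alph G)
  ; step    = stp
  ; initial = λ X → ∀ q → (q ∈ X) ⟺ InUR G (init G) q
  ; marked  = λ _ → ⊤
  }
  where
  stp : Subset (k G) → Maybe (Fin m) → Subset (k G) → Set
  stp X nothing Y = ⊥
  stp X (just σ) Y = DetStep G X σ Y

-- Renamings Δ(σ) = (σ,ε) ↦ inj₁ σ and Δ_R(σ) = (ε,σ) ↦ inj₂ σ.

Δ : {E : Set} → Aut E → Aut (E ⊎ E)
Δ {E} A = record
  { St = St A ; alph = al ; step = stp ; initial = initial A ; marked = marked A }
  where
  al : E ⊎ E → Bool
  al (inj₁ e) = alph A e
  al (inj₂ e) = false
  stp : St A → Maybe (E ⊎ E) → St A → Set
  stp p nothing q = step A p nothing q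
  stp p (just (inj₁ e)) q = step A p (just e) q
  stp p (just (inj₂ e)) q = ⊥

ΔR : {E : Set} → Aut E → Aut (E ⊎ E)
ΔR {E} A = record
  { St = St A ; alph = al ; step = stp ; initial = initial A ; marked = marked A }
  where
  al : E ⊎ E → Bool
  al (inj₁ e) = false
  al (inj₂ e) = alph A e
  stp : St A → Maybe (E ⊎ E) → St A → Set
  stp p nothing q = step A p nothing q
  stp p (just (inj₁ e)) q = ⊥
  stp p (just (inj₂ e)) q = step A p (just e) q

twoWay : {m : ℕ} → NFA m → Aut (Fin m ⊎ Fin m)
twoWay G = Δ (det G) ∥ ΔR (det (reverse G))

-- ψ-automaton.  Events of the family: (Fin m ⊎ Fin m) ⊎ Fin n, where
-- ψ_i = inj₂ i (pairwise distinct and new).  ⊥ is 'nothing'.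

psiAut : {E : Set} {n : ℕ} (D : Aut E) → (St D → Set) → Fin n → Aut (E ⊎ Fin n)
psiAut {E} {n} D Xψ i = record
  { St = Maybe (St D) ; alph = al ; step = stp
  ; initial = ini ; marked = mk }
  where
  al : E ⊎ Fin n → Bool
  al (inj₁ e) = alph D e
  al (inj₂ j) = ⌊ j ≟ i ⌋
  stp : Maybe (St D) → Maybe (E ⊎ Fin n) → Maybe (St D) → Set
  stp (just x) nothing (just y) = step D x nothing y
  stp (just x) (just (inj₁ e)) (just y) = step D x (just e) y
  stp (just x) (just (inj₂ j)) nothing = j ≡ i × Xψ x
  stp _ _ _ = ⊥
  ini : Maybe (St D) → Set
  ini (just x) = initial D x
  ini nothing = ⊥
  mk : Maybe (St D) → Set
  mk (just x) = ⊤
  mk nothing = ⊥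

PsiStates : {m : ℕ} (G : NFA m) → St (twoWay G) → Set
PsiStates G (X , XR) =
  Reachable (twoWay G) (X , XR) × (∀ q → q ∈ X → q ∈ XR → q ∈ secret G)

Hψ : {m n : ℕ} → (Fin n → NFA m) → Fin n → Aut ((Fin m ⊎ Fin m) ⊎ Fin n)
Hψ G i = psiAut (twoWay (G i)) (PsiStates (G i)) i

Gcomp : {m n : ℕ} → (Fin n → NFA m) → Aut (Fin m)
Gcomp {m} {n} G = Sync n (λ i → toAut (G i))

SecretOr : {m n : ℕ} (G : Fin n → NFA m) → St (Gcomp G) → Set
SecretOr G x = ∃[ i ] (x i ∈ secret (G i))

module Submission where

-- Suppose q₀ =s=> q =t=> in the composition.  Projecting onto component i
-- gives runs q₀ᵢ =sᵢ=> mᵢ =tᵢ=> rᵢ.  Feeding sᵢ forwards to det(Gᵢ) and then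
-- reverse(tᵢ) to det(Gᵢ,R) drives the two-way observer Hᵢ to a state (Xᵢ, Xᵢ,R)
-- in which every state of Xᵢ ∩ Xᵢ,R is reached by sᵢ from an initial state and
-- can still execute tᵢ.  These observer runs synchronise to a run of
-- H_{1,ψ1} ∥ ⋯ ∥ H_{n,ψn}; if some (Xᵢ, Xᵢ,R) were a ψᵢ-state, firing ψᵢ would
-- strand component i in the unmarked dead state ⊥, contradicting nonblocking.
-- So each Xᵢ ∩ Xᵢ,R contains a non-secret state yᵢ, and synchronising the
-- component runs through the yᵢ yields the run demanded by opacity.

open import Defs
open import Data.Nat using (ℕ; zero; suc; _≤_)
open import Data.Nat.Properties using (≤-pred; <-≤-trans; ≤-reflexive; n≮0)
open import Data.Fin using (Fin; _≟_)
open import Data.Fin.Properties using (any?)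
open import Data.Fin.Subset using (Subset; _∈_; _∉_; _⊆_; _-_; ∣_∣) renaming (⊤ to full)
open import Data.Fin.Subset.Properties
  using (_∈?_; ∈⊤; ∣⊤∣≡n; x∈p∧x≢y⇒x∈p-y; x∈p⇒p-x⊂p; x∈p⇒∣p-x∣<∣p∣)
open import Data.Bool using (true; false; if_then_else_)
open import Data.Bool.Properties using (∨-identityʳ) renaming (_≟_ to _≟ᵇ_)
open import Data.List using (List; []; _∷_; [_]; _++_; map; allFin) renaming (reverse to rev)
open import Data.List.Properties using (++-identityʳ; reverse-involutive; unfold-reverse)
open import Data.List.Membership.Propositional using () renaming (_∈_ to _∈ₗ_)
open import Data.List.Membership.Propositional.Properties using (∈-allFin)
open import Data.List.Relation.Unary.All as All using (All; []; _∷_)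
open import Data.List.Relation.Unary.All.Properties using (++⁺; ++⁻ˡ; ++⁻ʳ; map⁺)
open import Data.List.Relation.Unary.Any using (here; there)
open import Data.Vec using (tabulate)
open import Data.Vec.Properties using ([]=⇒lookup; lookup⇒[]=; lookup∘tabulate)
open import Data.Maybe using (just; nothing)
open import Data.Product using (Σ-syntax; ∃-syntax; ∃₂; _×_; _,_; proj₁; proj₂)
open import Data.Sum using (_⊎_; inj₁; inj₂)
open import Function using (_∘_)
open import Relation.Nullary using (Dec; yes; no; ¬_; ¬?; does; _×-dec_; contradiction)
open import Relation.Nullary.Decidable using (map′; dec-true; isYes≗does; decidable-stable)
open import Relation.Binary.PropositionalEquality
  using (_≡_; _≢_; refl; sym; cong; cong₂; subst; subst₂; module ≡-Reasoning) renaming (trans to ≡-trans)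

module _ {E : Set} {A : Aut E} where

  run-++ : ∀ {x y z u v} → Run A x u y → Run A y v z → Run A x (u ++ v) z
  run-++ done ρ′ = ρ′
  run-++ (tau st ρ) ρ′ = tau st (run-++ ρ ρ′)
  run-++ (obs st ρ) ρ′ = obs st (run-++ ρ ρ′)

  run-split : ∀ {x z} (u v : List E) → Run A x (u ++ v) z → ∃[ y ] (Run A x u y × Run A y v z)
  run-split [] v ρ = _ , done , ρ
  run-split (e ∷ u) v (tau st ρ) with run-split (e ∷ u) v ρ
  ... | y , ρ₁ , ρ₂ = y , tau st ρ₁ , ρ₂
  run-split (e ∷ u) v (obs st ρ) with run-split u v ρ
  ... | y , ρ₁ , ρ₂ = y , obs st ρ₁ , ρ₂

  run-uncons : ∀ {x z e s} → Run A x (e ∷ s) z →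
    ∃₂ λ a b → Run A x [] a × step A a (just e) b × Run A b s z
  run-uncons (tau st ρ) with run-uncons ρ
  ... | a , b , ρ₀ , st′ , ρ₁ = a , b , tau st ρ₀ , st′ , ρ₁
  run-uncons (obs st ρ) = _ , _ , done , st , ρ

-- Used, with f the identity, to
-- pass between G and G_R in both directions.
run-converse : ∀ {E} {A B : Aut E} (f : St A → St B) →
  (∀ {p e q} → step A p e q → step B (f q) e (f p)) →
  ∀ {p s q} → Run A p s q → Run B (f q) (rev s) (f p)
run-converse f conv done = done
run-converse {B = B} f conv {p} {q = q} (tau st ρ) =
  subst (λ w → Run B (f q) w (f p)) (++-identityʳ _) (run-++ (run-converse f conv ρ) (tau (conv st) done))
run-converse {B = B} f conv {p} {q = q} (obs {e = e} {s = s} st ρ) =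
  subst (λ w → Run B (f q) w (f p)) (sym (unfold-reverse e s)) (run-++ (run-converse f conv ρ) (obs (conv st) done))

proj : ∀ {E} → Aut E → List E → List E
proj A [] = []
proj A (e ∷ s) = if alph A e then e ∷ proj A s else proj A s

proj-++ : ∀ {E} (A : Aut E) u v → proj A (u ++ v) ≡ proj A u ++ proj A v
proj-++ A [] v = refl
proj-++ A (e ∷ u) v with alph A e
... | true = cong (e ∷_) (proj-++ A u v)
... | false = proj-++ A u v

proj-reverse : ∀ {E} (A : Aut E) s → proj A (rev s) ≡ rev (proj A s)
proj-reverse A [] = refl
proj-reverse A (e ∷ s) = begin
    proj A (rev (e ∷ s))          ≡⟨ cong (proj A) (unfold-reverse e s) ⟩
    proj A (rev s ++ [ e ])       ≡⟨ proj-++ A (rev s) [ e ] ⟩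
    proj A (rev s) ++ proj A [ e ] ≡⟨ cong (_++ proj A [ e ]) (proj-reverse A s) ⟩
    rev (proj A s) ++ proj A [ e ] ≡⟨ append-last ⟩
    rev (proj A (e ∷ s))          ∎
  where
  open ≡-Reasoning
  append-last : rev (proj A s) ++ proj A [ e ] ≡ rev (proj A (e ∷ s))
  append-last with alph A e
  ... | true = sym (unfold-reverse e (proj A s))
  ... | false = ++-identityʳ _

proj-map : ∀ {E F} (f : E → F) (A : Aut E) (B : Aut F) → (∀ e → alph B (f e) ≡ alph A e) →
  ∀ s → proj B (map f s) ≡ map f (proj A s)
proj-map f A B same [] = refl
proj-map f A B same (e ∷ s) rewrite same e with alph A e
... | true = cong (f e ∷_) (proj-map f A B same s)
... | false = proj-map f A B same s

Participates : ∀ {E} (A : Aut E) → St A → E → St A → Set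
Participates A a e b = (alph A e ≡ true → step A a (just e) b) × (alph A e ≡ false → b ≡ a)

record ProjectedStep {E} (A : Aut E) (x : St A) (e : E) (s : List E) (z : St A) : Set where
  field
    {before after} : St A
    τ-part         : Run A x [] before
    part           : Participates A before e after
    rest           : Run A after (proj A s) z

run-proj-uncons : ∀ {E} (A : Aut E) {x z e s} → Run A x (proj A (e ∷ s)) z → ProjectedStep A x e s z
run-proj-uncons A {e = e} ρ with alph A e in e∈?
... | true with run-uncons ρ
...   | _ , _ , ρ₀ , st , ρ₁ =
  record { τ-part = ρ₀ ; part = (λ _ → st) , λ e∉ → contradiction (≡-trans (sym e∈?) e∉) λ () ; rest = ρ₁ }
run-proj-uncons A ρ | false =
  record { τ-part = done ; part = (λ e∈ → contradiction (≡-trans (sym e∈?) e∈) λ ()) , (λ _ → refl) ; rest = ρ }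

upd : ∀ {n} {F : Fin n → Set} (x : ∀ i → F i) (i : Fin n) → F i → ∀ j → F j
upd x i v j with j ≟ i
... | yes refl = v
... | no _ = x j

upd-same : ∀ {n} {F : Fin n → Set} (x : ∀ i → F i) i v → upd x i v i ≡ v
upd-same x i v with i ≟ i
... | yes refl = refl
... | no i≢i = contradiction refl i≢i

upd-other : ∀ {n} {F : Fin n → Set} (x : ∀ i → F i) i v j → j ≢ i → upd x i v j ≡ x j
upd-other x i v j j≢i with j ≟ i
... | yes refl = contradiction refl j≢i
... | no _ = refl

module Composition {E : Set} {n : ℕ} (A : Fin n → Aut E) where

  S : Aut E
  S = Sync n A

  Covered : List E → Set
  Covered = All (λ e → ∃[ i ] alph (A i) e ≡ true)

  covered : ∀ {x y s} → Run S x s y → Covered s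
  covered done = []
  covered (tau _ ρ) = covered ρ
  covered (obs (c , _) ρ) = c ∷ covered ρ

  project : ∀ {x y s} → Run S x s y → ∀ i → Run (A i) (x i) (proj (A i) s) (y i)
  project done i = done
  project (tau (j , st , others) ρ) i with i ≟ j
  ... | yes refl = tau st (project ρ i)
  ... | no i≢j = subst (λ w → Run (A i) w _ _) (others i i≢j) (project ρ i)
  project (obs {e = e} (_ , part) ρ) i with alph (A i) e in eq
  ... | true = obs (proj₁ (part i) eq) (project ρ i)
  ... | false = subst (λ w → Run (A i) w _ _) (proj₂ (part i) eq) (project ρ i)

  lift-τ : ∀ (x : ∀ i → St (A i)) i {u v} → x i ≡ u → Run (A i) u [] v →
    ∃[ y ] (y i ≡ v × (∀ j → j ≢ i → y j ≡ x j) × Run S x [] y)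
  lift-τ x i eq done = x , eq , (λ _ _ → refl) , done
  lift-τ x i refl (tau {q = q} st ρ) with lift-τ (upd x i q) i (upd-same x i q) ρ
  ... | y , yi , others , R =
    y , yi , (λ j j≢i → ≡-trans (others j j≢i) (upd-other x i q j j≢i)) , tau (i , first , upd-other x i q) R
    where
    first : step (A i) (x i) nothing (upd x i q i)
    first = subst (step (A i) (x i) nothing) (sym (upd-same x i q)) st

  -- Independent τ-runs of all components, performed one component at a time
  -- for the components still listed in l.
  merge-τ : ∀ (l : List (Fin n)) (x y : ∀ i → St (A i)) → (∀ i → Run (A i) (x i) [] (y i)) →
    (∀ i → x i ≡ y i ⊎ i ∈ₗ l) → ∃[ z ] ((∀ i → z i ≡ y i) × Run S x [] z)
  merge-τ [] x y ρ pending = x , (λ i → arrived (pending i)) , done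
    where
    arrived : ∀ {i} → x i ≡ y i ⊎ i ∈ₗ [] → x i ≡ y i
    arrived (inj₁ eq) = eq
  merge-τ (j ∷ l) x y ρ pending =
    let x′ , x′j , others , R = lift-τ x j refl (ρ j)
        z , z≡y , R′ = merge-τ l x′ y (runs′ x′ x′j others) (pending′ x′ x′j others)
    in z , z≡y , run-++ R R′
    where
    runs′ : ∀ x′ → x′ j ≡ y j → (∀ i → i ≢ j → x′ i ≡ x i) → ∀ i → Run (A i) (x′ i) [] (y i)
    runs′ x′ x′j others i with i ≟ j
    ... | yes refl = subst (λ w → Run (A i) w [] (y i)) (sym x′j) done
    ... | no i≢j = subst (λ w → Run (A i) w [] (y i)) (sym (others i i≢j)) (ρ i)
    pending′ : ∀ x′ → x′ j ≡ y j → (∀ i → i ≢ j → x′ i ≡ x i) → ∀ i → x′ i ≡ y i ⊎ i ∈ₗ l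
    pending′ x′ x′j others i with i ≟ j | pending i
    ... | yes refl | _ = inj₁ x′j
    ... | no i≢j | inj₁ eq = inj₁ (≡-trans (others i i≢j) eq)
    ... | no i≢j | inj₂ (here i≡j) = contradiction i≡j i≢j
    ... | no i≢j | inj₂ (there i∈l) = inj₂ i∈l

  compose : ∀ s (x y : ∀ i → St (A i)) → Covered s →
    (∀ i → Run (A i) (x i) (proj (A i) s) (y i)) → ∃[ z ] ((∀ i → z i ≡ y i) × Run S x s z)
  compose [] x y [] ρ = merge-τ (allFin n) x y ρ (λ i → inj₂ (∈-allFin i))
  compose (e ∷ s) x y (c ∷ cs) ρ =
    let a , a≡before , R₀ = compose [] x (before ∘ D) [] (τ-part ∘ D)
        z , z≡y , R₁ = compose s (after ∘ D) y cs (rest ∘ D)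
        sync-e : step S a (just e) (after ∘ D)
        sync-e = c , λ i → subst (λ w → Participates (A i) w e (after (D i))) (sym (a≡before i)) (part (D i))
    in z , z≡y , run-++ R₀ (obs sync-e R₁)
    where
    open ProjectedStep
    D : ∀ i → ProjectedStep (A i) (x i) e s (y i)
    D i = run-proj-uncons (A i) (ρ i)

-- ψ-automata: in a nonblocking composition of ψ-automata no reachable state
-- has a component in a ψ-state, since firing ψᵢ there would strand
-- component i in the unmarked dead state ⊥.

module ΨComposition {E : Set} {n : ℕ} (D : Fin n → Aut E) (Xψ : ∀ i → St (D i) → Set) where

  Ψ : Fin n → Aut (E ⊎ Fin n)
  Ψ i = psiAut (D i) (Xψ i) i

  open Composition Ψ using (S; project)

  stuck : ∀ i {w y} → Run (Ψ i) nothing w y → y ≡ nothing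
  stuck i done = refl
  stuck i (tau () _)
  stuck i (obs () _)

  strand : (∀ i → St (Ψ i)) → Fin n → ∀ i → St (Ψ i)
  strand z i = upd z i nothing

  ψ-step : ∀ z i {x} → z i ≡ just x → Xψ i x → step S z (just (inj₂ i)) (strand z i)
  ψ-step z i zi≡x ψx = (i , own) , participates
    where
    own : alph (Ψ i) (inj₂ i) ≡ true
    own = ≡-trans (isYes≗does (i ≟ i)) (dec-true (i ≟ i) refl)
    participates : ∀ c → Participates (Ψ c) (z c) (inj₂ i) (strand z i c)
    participates c with i ≟ c
    ... | yes refl = (λ _ → subst₂ (λ a b → step (Ψ i) a (just (inj₂ i)) b)
                                   (sym zi≡x) (sym (upd-same z i nothing)) (refl , ψx)) , λ ()
    ... | no i≢c = (λ ()) , λ _ → upd-other z i nothing c (i≢c ∘ sym)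

  ψ-unreachable : Nonblocking S → ∀ z → Reachable S z → ∀ i {x} → z i ≡ just x → ¬ Xψ i x
  ψ-unreachable nb z (z₀ , z₀-init , w , R) i zi≡x ψx =
    let y , u , R′ , y-marked = nb (strand z i) (z₀ , z₀-init , w ++ [ inj₂ i ] , run-++ R (obs (ψ-step z i zi≡x ψx) done))
        dead = stuck i (subst (λ v → Run (Ψ i) v (proj (Ψ i) u) (y i)) (upd-same z i nothing) (project R′ i))
    in subst (marked (Ψ i)) dead (y-marked i)

lift-ψ : ∀ {E : Set} {n} (D : Aut E) (Xψ : St D → Set) (i : Fin n) {x s y} → Run D x s y →
  Run (psiAut D Xψ i) (just x) (map inj₁ s) (just y)
lift-ψ D Xψ i done = done
lift-ψ D Xψ i (tau st ρ) = tau st (lift-ψ D Xψ i ρ)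
lift-ψ D Xψ i (obs st ρ) = obs st (lift-ψ D Xψ i ρ)

-- Decidability of reachability in a finite graph, by depth-first search
-- bounded by the number of vertices not yet visited.

module Reachability {k : ℕ} (T : Fin k → Fin k → Set) (T? : ∀ a b → Dec (T a b)) where

  data Path (V : Subset k) : Fin k → Fin k → Set where
    here : ∀ {a} → Path V a a
    next : ∀ {a b c} → T a b → b ∈ V → Path V b c → Path V a c

  weaken : ∀ {V W a c} → V ⊆ W → Path V a c → Path W a c
  weaken V⊆W here = here
  weaken V⊆W (next t bV π) = next t (V⊆W bV) (weaken V⊆W π)

  -- Removing loops through r: a path either avoids r after its start, or
  -- has a suffix starting at r that does not return to r.
  cut : ∀ {V a c} → Path V a c → (r : Fin k) → (a ≢ r × Path (V - r) a c) ⊎ Path (V - r) r c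
  cut {a = a} here r with a ≟ r
  ... | yes refl = inj₂ here
  ... | no a≢r = inj₁ (a≢r , here)
  cut {a = a} (next t bV π) r with cut π r
  ... | inj₂ π′ = inj₂ π′
  ... | inj₁ (b≢r , π′) with a ≟ r
  ...   | yes refl = inj₂ (next t (x∈p∧x≢y⇒x∈p-y bV b≢r) π′)
  ...   | no a≢r = inj₁ (a≢r , next t (x∈p∧x≢y⇒x∈p-y bV b≢r) π′)

  FirstStep : Subset k → Fin k → Fin k → Fin k → Set
  FirstStep V a c b = b ∈ V × T a b × Path (V - b) b c

  first-step : ∀ {V a c} → a ≢ c → Path V a c → ∃[ b ] FirstStep V a c b
  first-step a≢c here = contradiction refl a≢c
  first-step a≢c (next {b = b} t bV π) with cut π b
  ... | inj₁ (b≢b , _) = contradiction refl b≢b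
  ... | inj₂ π′ = b , bV , t , π′

  -- Path existence is decidable: either a = c, or some first step b ∈ V
  -- leads to a path inside the smaller set V - b.
  path? : ∀ f V → ∣ V ∣ ≤ f → ∀ a c → Dec (Path V a c)
  step? : ∀ f V → ∣ V ∣ ≤ f → ∀ a c b → Dec (FirstStep V a c b)

  path? f V bound a c with a ≟ c
  ... | yes refl = yes here
  ... | no a≢c = map′ (λ (b , bV , t , π) → next t bV (weaken (proj₁ (x∈p⇒p-x⊂p bV)) π))
                      (first-step a≢c) (any? (step? f V bound a c))

  step? zero V bound a c b = no λ (bV , _) → n≮0 (<-≤-trans (x∈p⇒∣p-x∣<∣p∣ bV) bound)
  step? (suc f) V bound a c b with b ∈? V
  ... | no b∉V = no (b∉V ∘ proj₁)
  ... | yes bV = map′ (bV ,_) proj₂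
    (T? a b ×-dec path? f (V - b) (≤-pred (<-≤-trans (x∈p⇒∣p-x∣<∣p∣ bV) bound)) b c)

  reachable? : ∀ a c → Dec (Path full a c)
  reachable? = path? k full (≤-reflexive (∣⊤∣≡n k))

τ-reachable? : ∀ {m} (G : NFA m) p q → Dec (Run (toAut G) p [] q)
τ-reachable? G p q = map′ toRun fromRun (reachable? p q)
  where
  open Reachability (λ a b → trans G a nothing b ≡ true) (λ a b → trans G a nothing b ≟ᵇ true)
  toRun : ∀ {a c} → Path full a c → Run (toAut G) a [] c
  toRun here = done
  toRun (next t _ π) = tau t (toRun π)
  fromRun : ∀ {a c} → Run (toAut G) a [] c → Path full a c
  fromRun done = here
  fromRun (tau t ρ) = next t ∈⊤ (fromRun ρ)

subsetOf : ∀ {k} (P : Fin k → Set) → (∀ q → Dec (P q)) → Σ[ X ∈ Subset k ] (∀ q → (q ∈ X) ⟺ P q)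
subsetOf {k} P P? = X , λ q → to q , from q
  where
  X : Subset k
  X = tabulate (λ q → does (P? q))
  to : ∀ q → q ∈ X → P q
  to q q∈X with P? q | ≡-trans (sym (lookup∘tabulate (λ q → does (P? q)) q)) ([]=⇒lookup q∈X)
  ... | yes p | _ = p
  from : ∀ q → P q → q ∈ X
  from q p = lookup⇒[]= q X (≡-trans (lookup∘tabulate (λ q → does (P? q)) q) (dec-true (P? q) p))

module Estimator {m : ℕ} (G : NFA m) where

  A : Aut (Fin m)
  A = toAut G

  Closed : Subset (k G) → Set
  Closed X = ∀ {x q} → x ∈ X → Run A x [] q → q ∈ X

  Post : Subset (k G) → Fin m → Fin (k G) → Set
  Post X σ q = ∃[ x ] (x ∈ X × ∃[ y ] (trans G x (just σ) y ≡ true × Run A y [] q))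

  post? : ∀ X σ q → Dec (Post X σ q)
  post? X σ q = any? λ x → (x ∈? X) ×-dec any? λ y → (trans G x (just σ) y ≟ᵇ true) ×-dec τ-reachable? G y q

  post : Subset (k G) → Fin m → Subset (k G)
  post X σ = proj₁ (subsetOf (Post X σ) (post? X σ))

  post-spec : ∀ X σ q → (q ∈ post X σ) ⟺ Post X σ q
  post-spec X σ = proj₂ (subsetOf (Post X σ) (post? X σ))

  post-closed : ∀ X σ → Closed (post X σ)
  post-closed X σ {q = q} p∈ ρ with proj₁ (post-spec X σ _) p∈
  ... | x , x∈X , y , st , ρ₀ = proj₂ (post-spec X σ q) (x , x∈X , y , st , run-++ ρ₀ ρ)

  post-runs : ∀ X σ s q → Closed X →
    (∃[ y ] (y ∈ post X σ × Run A y s q)) ⟺ (∃[ x ] (x ∈ X × Run A x (σ ∷ s) q))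
  post-runs X σ s q cl = to , from
    where
    to : ∃[ y ] (y ∈ post X σ × Run A y s q) → ∃[ x ] (x ∈ X × Run A x (σ ∷ s) q)
    to (y , y∈ , ρ) with proj₁ (post-spec X σ y) y∈
    ... | x , x∈X , y₀ , st , ρ₀ = x , x∈X , obs st (run-++ ρ₀ ρ)
    from : ∃[ x ] (x ∈ X × Run A x (σ ∷ s) q) → ∃[ y ] (y ∈ post X σ × Run A y s q)
    from (x , x∈X , ρ) with run-uncons ρ
    ... | a , b , ρ₀ , st , ρ₁ = b , proj₂ (post-spec X σ b) (a , cl x∈X ρ₀ , b , st , done) , ρ₁

  track : ∀ X → Closed X → ∀ s → (∃[ x ] (x ∈ X × ∃[ z ] Run A x s z)) →
    ∃[ Y ] (Run (det G) X s Y × (∀ q → (q ∈ Y) ⟺ (∃[ x ] (x ∈ X × Run A x s q))))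
  track X cl [] _ = X , done , λ q → (λ q∈X → q , q∈X , done) , λ (x , x∈X , ρ) → cl x∈X ρ
  track X cl (σ ∷ s) (x , x∈X , z , ρ) =
    let b , b∈post , ρ₁ = proj₂ (post-runs X σ s z cl) (x , x∈X , ρ)
        Y , R , Y-spec = track (post X σ) (post-closed X σ) s (b , b∈post , z , ρ₁)
    in Y , obs ((b , b∈post) , post-spec X σ) R ,
       λ q → proj₁ (post-runs X σ s q cl) ∘ proj₁ (Y-spec q) , proj₂ (Y-spec q) ∘ proj₂ (post-runs X σ s q cl)

  initial? : ∀ q → Dec (InUR G (init G) q)
  initial? q = any? λ p → (p ∈? init G) ×-dec τ-reachable? G p q

  initialSet : Subset (k G)
  initialSet = proj₁ (subsetOf (InUR G (init G)) initial?)

  initialSet-spec : ∀ q → (q ∈ initialSet) ⟺ InUR G (init G) q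
  initialSet-spec = proj₂ (subsetOf (InUR G (init G)) initial?)

  initialSet-closed : Closed initialSet
  initialSet-closed {q = q} x∈ ρ with proj₁ (initialSet-spec _) x∈
  ... | p , p-init , ρ₀ = proj₂ (initialSet-spec q) (p , p-init , run-++ ρ₀ ρ)

  det-alph : ∀ {X σ Y} → DetStep G X σ Y → memb σ (alph G) ≡ true
  det-alph ((q , q∈Y) , spec) with proj₁ (spec q) q∈Y
  ... | x , _ , y , st , _ = []=⇒lookup (wf G x _ y st)

twoWayWord : ∀ {E : Set} → List E → List E → List (E ⊎ E)
twoWayWord s t = map inj₁ s ++ map inj₂ (rev t)

lift-forward : ∀ {m} (G : NFA m) {X s Y} Z → Run (det G) X s Y → Run (twoWay G) (X , Z) (map inj₁ s) (Y , Z)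
lift-forward G Z done = done
lift-forward G Z (obs {e = σ} ds ρ) = obs move (lift-forward G Z ρ)
  where
  move : step (twoWay G) (_ , Z) (just (inj₁ σ)) (_ , Z)
  move rewrite Estimator.det-alph G ds = refl , ((λ _ → ds) , λ ()) , ((λ ()) , λ _ → refl)

lift-backward : ∀ {m} (G : NFA m) {Z s Z′} X → Run (det (reverse G)) Z s Z′ → Run (twoWay G) (X , Z) (map inj₂ s) (X , Z′)
lift-backward G X done = done
lift-backward G X (obs {e = σ} ds ρ) = obs move (lift-backward G X ρ)
  where
  move : step (twoWay G) (X , _) (just (inj₂ σ)) (X , _)
  move rewrite Estimator.det-alph (reverse G) ds = refl , ((λ ()) , λ _ → refl) , ((λ _ → ds) , λ ())

record TwoWayTrace {m} (G : NFA m) (s t : List (Fin m)) : Set where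
  field
    start end  : St (twoWay G)
    start-init : initial (twoWay G) start
    trace      : Run (twoWay G) start (twoWayWord s t) end
    sound      : ∀ q → q ∈ proj₁ end → q ∈ proj₂ end →
                 (∃[ p ] (p ∈ init G × Run (toAut G) p s q)) × (∃[ r ] Run (toAut G) q t r)

two-way-trace : ∀ {m} (G : NFA m) {s t p₀ q r} → p₀ ∈ init G →
  Run (toAut G) p₀ s q → Run (toAut G) q t r → TwoWayTrace G s t
two-way-trace G {s} {t} {p₀} {q} {r} p₀-init ρs ρt =
  let X , RX , X-spec = F.track F.initialSet F.initialSet-closed s
                          (p₀ , proj₂ (F.initialSet-spec p₀) (p₀ , p₀-init , done) , q , ρs)
      XR , RXR , XR-spec = B.track B.initialSet B.initialSet-closed (rev t)
                          (r , proj₂ (B.initialSet-spec r) (r , ∈⊤ , done) , q , run-converse (λ x → x) (λ st → st) ρt)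
  in record
    { start = F.initialSet , B.initialSet
    ; end = X , XR
    ; start-init = F.initialSet-spec , B.initialSet-spec
    ; trace = run-++ (lift-forward G B.initialSet RX) (lift-backward G X RXR)
    ; sound = λ q q∈X q∈XR → forward (proj₁ (X-spec q) q∈X) , backward (proj₁ (XR-spec q) q∈XR)
    }
  where
  module F = Estimator G
  module B = Estimator (reverse G)
  forward : ∀ {q} → ∃[ x ] (x ∈ F.initialSet × Run (toAut G) x s q) → ∃[ p ] (p ∈ init G × Run (toAut G) p s q)
  forward (x , x∈ , ρ) with proj₁ (F.initialSet-spec x) x∈
  ... | p , p-init , ρ₀ = p , p-init , run-++ ρ₀ ρ
  backward : ∀ {q} → ∃[ x ] (x ∈ B.initialSet × Run (toAut (reverse G)) x (rev t) q) → ∃[ r ] Run (toAut G) q t r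
  backward (x , _ , ρ) = x , subst (λ w → Run (toAut G) _ w x) (reverse-involutive t) (run-converse (λ x → x) (λ st → st) ρ)

point-outside : ∀ {k} (X Y S : Subset k) → ¬ (∀ q → q ∈ X → q ∈ Y → q ∈ S) → ∃[ q ] (q ∈ X × q ∈ Y × q ∉ S)
point-outside X Y S ¬⊆ with any? (λ q → (q ∈? X) ×-dec (q ∈? Y) ×-dec ¬? (q ∈? S))
... | yes found = found
... | no none = contradiction (λ q q∈X q∈Y → decidable-stable (q ∈? S) λ q∉S → none (q , q∈X , q∈Y , q∉S)) ¬⊆

record ComponentWitness {m} (G : NFA m) (s t : List (Fin m)) : Set where
  field
    {origin current final} : Fin (k G)
    origin-init       : origin ∈ init G
    current-nonsecret : current ∉ secret G
    run-s             : Run (toAut G) origin s current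
    run-t             : Run (toAut G) current t final

module Observers {m n : ℕ} (G : Fin n → NFA m) where

  module CG = Composition (λ i → toAut (G i))
  module CH = Composition (Hψ G)

  observerWord : List (Fin m) → List (Fin m) → List ((Fin m ⊎ Fin m) ⊎ Fin n)
  observerWord s t = map inj₁ (twoWayWord s t)

  proj-observerWord : ∀ i s t →
    proj (Hψ G i) (observerWord s t) ≡ map inj₁ (twoWayWord (proj (toAut (G i)) s) (proj (toAut (G i)) t))
  proj-observerWord i s t = begin
      proj (Hψ G i) (map inj₁ (twoWayWord s t))
    ≡⟨ proj-map inj₁ (twoWay (G i)) (Hψ G i) (λ _ → refl) (twoWayWord s t) ⟩
      map inj₁ (proj H (map inj₁ s ++ map inj₂ (rev t)))
    ≡⟨ cong (map inj₁) (proj-++ H (map inj₁ s) (map inj₂ (rev t))) ⟩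
      map inj₁ (proj H (map inj₁ s) ++ proj H (map inj₂ (rev t)))
    ≡⟨ cong (map inj₁) (cong₂ _++_ (proj-map inj₁ Gᵢ H (λ _ → ∨-identityʳ _) s)
                                   (proj-map inj₂ Gᵢ H (λ _ → refl) (rev t))) ⟩
      map inj₁ (map inj₁ (proj Gᵢ s) ++ map inj₂ (proj Gᵢ (rev t)))
    ≡⟨ cong (λ w → map inj₁ (map inj₁ (proj Gᵢ s) ++ map inj₂ w)) (proj-reverse Gᵢ t) ⟩
      map inj₁ (twoWayWord (proj Gᵢ s) (proj Gᵢ t))
    ∎
    where
    open ≡-Reasoning
    H : Aut (Fin m ⊎ Fin m)
    H = twoWay (G i)
    Gᵢ : Aut (Fin m)
    Gᵢ = toAut (G i)

  covered-observerWord : ∀ {s t} → CG.Covered s → CG.Covered t → CH.Covered (observerWord s t)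
  covered-observerWord {s} {t} cs ct =
    map⁺ (++⁺ (map⁺ (All.map (λ (i , e∈) → i , ≡-trans (∨-identityʳ _) e∈) cs))
              (map⁺ (All.map (λ (i , e∈) → i , e∈) (all-reverse t ct))))
    where
    all-reverse : ∀ {P : Fin m → Set} v → All P v → All P (rev v)
    all-reverse [] [] = []
    all-reverse (e ∷ v) (p ∷ ps) rewrite unfold-reverse e v = ++⁺ (all-reverse v ps) (p ∷ [])

  -- The observer runs of covered traces synchronise to a run of
  -- H_{1,ψ1} ∥ ⋯ ∥ H_{n,ψn} from its initial state; nonblocking then forbids
  -- every final estimate (X_i, X_i,R) to be a ψ-state, so X_i ∩ X_i,R has a
  -- non-secret state, which is a witness for component i.
  component-witness : Nonblocking (Sync n (Hψ G)) → ∀ {s t} → CG.Covered s → CG.Covered t →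
    (T : ∀ i → TwoWayTrace (G i) (proj (toAut (G i)) s) (proj (toAut (G i)) t)) →
    ∀ i → ComponentWitness (G i) (proj (toAut (G i)) s) (proj (toAut (G i)) t)
  component-witness nb {s} {t} cs ct T i =
    let z , z≡ , R = synchronised
        y , y∈X , y∈XR , y∉S = point-outside (proj₁ (end (T i))) (proj₂ (end (T i))) (secret (G i))
          λ common⊆secret → ψ-unreachable nb z (just ∘ start ∘ T , start-init ∘ T , observerWord s t , R) i (z≡ i)
                                ((start (T i) , start-init (T i) , _ , trace (T i)) , common⊆secret)
        (p , p-init , ρs) , (r , ρt) = sound (T i) y y∈X y∈XR
    in record { origin-init = p-init ; current-nonsecret = y∉S ; run-s = ρs ; run-t = ρt }
    where
    open TwoWayTrace
    open ΨComposition (λ i → twoWay (G i)) (λ i → PsiStates (G i)) using (ψ-unreachable)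
    synchronised : ∃[ z ] ((∀ i → z i ≡ just (end (T i))) ×
                           Run (Sync n (Hψ G)) (λ i → just (start (T i))) (observerWord s t) z)
    synchronised = CH.compose (observerWord s t) (just ∘ start ∘ T) (just ∘ end ∘ T)
      (covered-observerWord cs ct)
      λ j → subst (λ w → Run (Hψ G j) (just (start (T j))) w (just (end (T j)))) (sym (proj-observerWord j s t))
                  (lift-ψ (twoWay (G j)) (PsiStates (G j)) j (trace (T j)))

theorem6 : {m n : ℕ} (G : Fin n → NFA m) →
    Nonblocking (Sync n (Hψ G)) →
    InfStepOpaque (Gcomp G) (SecretOr G)
theorem6 {m} {n} G nb q₀ q₀-init s t (r , ρ) _ =
  (λ i → origin (W i)) , (λ i → origin-init (W i)) , y , run-y , y-nonsecret , proj₁ from-y , proj₂ (proj₂ from-y)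
  where
  open Observers G
  open ComponentWitness
  Gᵢ : Fin n → Aut (Fin m)
  Gᵢ i = toAut (G i)
  cs : CG.Covered s
  cs = ++⁻ˡ s (CG.covered ρ)
  ct : CG.Covered t
  ct = ++⁻ʳ s (CG.covered ρ)
  component-runs : ∀ i → ∃[ q ] (Run (Gᵢ i) (q₀ i) (proj (Gᵢ i) s) q × Run (Gᵢ i) q (proj (Gᵢ i) t) (r i))
  component-runs i = run-split _ _ (subst (λ w → Run (Gᵢ i) (q₀ i) w (r i)) (proj-++ (Gᵢ i) s t) (CG.project ρ i))
  W : ∀ i → ComponentWitness (G i) (proj (Gᵢ i) s) (proj (Gᵢ i) t)
  W = component-witness nb cs ct λ i →
    two-way-trace (G i) (q₀-init i) (proj₁ (proj₂ (component-runs i))) (proj₂ (proj₂ (component-runs i)))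
  to-y : ∃[ y ] ((∀ i → y i ≡ current (W i)) × Run (Gcomp G) (λ i → origin (W i)) s y)
  to-y = CG.compose s (λ i → origin (W i)) (λ i → current (W i)) cs (λ i → run-s (W i))
  y : St (Gcomp G)
  y = proj₁ to-y
  run-y : Run (Gcomp G) (λ i → origin (W i)) s y
  run-y = proj₂ (proj₂ to-y)
  y-nonsecret : ¬ SecretOr G y
  y-nonsecret (i , sec) = current-nonsecret (W i) (subst (_∈ secret (G i)) (proj₁ (proj₂ to-y) i) sec)
  from-y : ∃[ r′ ] ((∀ i → r′ i ≡ final (W i)) × Run (Gcomp G) y t r′)
  from-y = CG.compose t y (λ i → final (W i)) ct
    λ i → subst (λ v → Run (Gᵢ i) v (proj (Gᵢ i) t) (final (W i))) (sym (proj₁ (proj₂ to-y) i)) (run-t (W i))
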